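{- For any graph $G$ of order $n$ with maximum degree $\Delta\ge 1$, $i_{dR}(G)\ge \frac{2n}{\Delta}+\frac{\Delta-2}{\Delta}\, i(G)$, and this bound is sharp.
   Context: $i(G)$ is the independent domination number: the minimum cardinality of a set that is both independent and dominating in $G$. An independent double Roman dominating function (IDRDF) on $G=(V,E)$ is a function $f:V\to\{0,1,2,3\}$ such that: every vertex $v$ with $f(v)=0$ has at least two neighbors $w$ with $f(w)=2$ or at least one neighbor $w$ with $f(w)=3$; every vertex $v$ with $f(v)=1$ has a neighbor $w$ with $f(w)\ge 2$; and $\{v: f(v)>0\}$ is independent. $i_{dR}(G)$ is the minimum weight $\sum_v f(v)$ of an IDRDF on $G$. -}

module Defs where

open import Data.Nat using (ℕ; zero; suc; _+_; _*_; _≤_; _≥_)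
open import Data.Fin using (Fin; toℕ)
open import Data.Bool using (Bool; true; false; if_then_else_)
open import Data.List using (List; map; allFin)
open import Data.Nat.ListAction using (sum)
open import Data.Product using (Σ; ∃; _×_; _,_)
open import Data.Sum using (_⊎_)
open import Relation.Binary.PropositionalEquality using (_≡_; _≢_)

record Graph (n : ℕ) : Set where
  field
    adj   : Fin n → Fin n → Bool
    sym   : ∀ u v → adj u v ≡ adj v u
    irrefl : ∀ v → adj v v ≡ false
open Graph public

count : {n : ℕ} → (Fin n → Bool) → ℕ
count {n} p = sum (map (λ w → if p w then 1 else 0) (allFin n))

degree : {n : ℕ} → Graph n → Fin n → ℕ
degree G v = count (adj G v)

MaxDegree : {n : ℕ} → Graph n → ℕ → Set
MaxDegree {n} G Δ = (∀ v → degree G v ≤ Δ) × (∃ λ v → degree G v ≡ Δ)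

Independent : {n : ℕ} → Graph n → (Fin n → Bool) → Set
Independent G S = ∀ u v → S u ≡ true → S v ≡ true → adj G u v ≡ false

Dominating : {n : ℕ} → Graph n → (Fin n → Bool) → Set
Dominating G S = ∀ v → S v ≡ false → ∃ λ w → S w ≡ true × adj G v w ≡ true

IsIndDomSet : {n : ℕ} → Graph n → (Fin n → Bool) → Set
IsIndDomSet G S = Independent G S × Dominating G S

IsIndDomNumber : {n : ℕ} → Graph n → ℕ → Set
IsIndDomNumber G k =
  (∃ λ S → IsIndDomSet G S × count S ≡ k) ×
  (∀ S → IsIndDomSet G S → k ≤ count S)

weight : {n : ℕ} → (Fin n → Fin 4) → ℕ
weight {n} f = sum (map (λ v → toℕ (f v)) (allFin n))

IsIDRDF : {n : ℕ} → Graph n → (Fin n → Fin 4) → Set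
IsIDRDF G f =
  (∀ v → toℕ (f v) ≡ 0 →
       (∃ λ u → ∃ λ w → u ≢ w × adj G v u ≡ true × adj G v w ≡ true
                        × toℕ (f u) ≡ 2 × toℕ (f w) ≡ 2)
     ⊎ (∃ λ w → adj G v w ≡ true × toℕ (f w) ≡ 3)) ×
  (∀ v → toℕ (f v) ≡ 1 → ∃ λ w → adj G v w ≡ true × toℕ (f w) ≥ 2) ×
  (∀ u v → toℕ (f u) ≥ 1 → toℕ (f v) ≥ 1 → adj G u v ≡ false)

IsIDRNumber : {n : ℕ} → Graph n → ℕ → Set
IsIDRNumber G k =
  (∃ λ f → IsIDRDF G f × weight f ≡ k) ×
  (∀ f → IsIDRDF G f → k ≤ weight f)

-- Let f be an IDRDF and n_j = |f⁻¹(j)|, so n = n₀ + n₁ + n₂ + n₃ and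
-- w(f) = n₁ + 2n₂ + 3n₃.  All inequalities come from one double-counting
-- (discharging) lemma: if every vertex sends at most M(u) along each of its
-- ≤ Δ edges, the total received is at most Δ·Σ M.  It gives
--   * 2n₀ ≤ Δ(n₂ + 2n₃), since a 0-vertex has two 2-neighbours or a 3-neighbour;
--   * n ≤ (1 + Δ)|T| for every dominating set T;
--   * 3n₀ + n₁ ≤ n₂ + 3n₃ when Δ = 1 (no vertex has two neighbours).
-- The positive vertices of f form an independent dominating set, so
-- i ≤ n₁ + n₂ + n₃.  For Δ ≥ 2 the bound follows from the first and last facts,
-- for Δ = 1 from the second (n ≤ 2i) and third, by linear arithmetic.  The star
-- K₁,Δ (i = 1, i_dR = 3) attains equality; minimality of its i_dR is again
-- the lower bound.

module Submission where

open import Defs hiding (sym)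
open import Data.Nat using (ℕ; zero; suc; _+_; _*_; _≤_; _≥_; z≤n; s≤s)
open import Data.Nat.Properties
open import Data.Nat.Tactic.RingSolver using (solve-∀)
open import Data.Fin using (Fin; toℕ; punchIn; punchOut) renaming (zero to fzero; suc to fsuc)
open import Data.Fin.Properties using (punchIn-punchOut)
open import Data.Bool using (Bool; true; false; if_then_else_)
open import Data.List using (map; allFin; tabulate)
open import Data.List.Properties using (map-tabulate)
import Data.Nat.ListAction as List
open import Algebra.Properties.Semiring.Sum +-*-semiring
  using (sum-syntax; sum-cong-≗; sum-replicate-zero; sum-remove; ∑-distrib-+; ∑-comm; *-distribˡ-sum; *-distribʳ-sum)
open import Data.Product using (Σ; ∃; _×_; _,_; proj₁; proj₂)
open import Data.Sum using (inj₁; inj₂)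
open import Data.Empty using (⊥-elim)
open import Relation.Nullary using (does)
open import Relation.Binary.PropositionalEquality
  using (_≡_; _≢_; refl; sym; trans; cong; cong₂; subst; subst₂; module ≡-Reasoning)
open import Function using (_∘_; id)

ind : Bool → ℕ
ind b = if b then 1 else 0

listSum≡∑ : ∀ {n} (g : Fin n → ℕ) → List.sum (map g (allFin n)) ≡ ∑[ v < n ] g v
listSum≡∑ {n} g = trans (cong List.sum (map-tabulate id g)) (tabulated g)
  where
  tabulated : ∀ {m} (h : Fin m → ℕ) → List.sum (tabulate h) ≡ ∑[ v < m ] h v
  tabulated {zero} h = refl
  tabulated {suc m} h = cong (h fzero +_) (tabulated (h ∘ fsuc))

count≡∑ : ∀ {n} (p : Fin n → Bool) → count p ≡ ∑[ v < n ] ind (p v)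
count≡∑ p = listSum≡∑ (λ v → ind (p v))

weight≡∑ : ∀ {n} (f : Fin n → Fin 4) → weight f ≡ ∑[ v < n ] toℕ (f v)
weight≡∑ f = listSum≡∑ (λ v → toℕ (f v))

∑-mono-≤ : ∀ {n} {g h : Fin n → ℕ} → (∀ v → g v ≤ h v) → ∑[ v < n ] g v ≤ ∑[ v < n ] h v
∑-mono-≤ {zero} le = z≤n
∑-mono-≤ {suc n} le = +-mono-≤ (le fzero) (∑-mono-≤ (le ∘ fsuc))

∑-const-1 : ∀ n → ∑[ v < n ] 1 ≡ n
∑-const-1 zero = refl
∑-const-1 (suc n) = cong suc (∑-const-1 n)

term≤∑ : ∀ {n} (g : Fin n → ℕ) w → g w ≤ ∑[ v < n ] g v
term≤∑ {suc n} g w = ≤-trans (m≤m+n (g w) _) (≤-reflexive (sym (sum-remove {i = w} g)))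

two-terms≤∑ : ∀ {n} (g : Fin n → ℕ) w u → w ≢ u → g w + g u ≤ ∑[ v < n ] g v
two-terms≤∑ {suc n} g w u w≢u = begin
    g w + g u
  ≡⟨ cong (λ x → g w + g x) (sym (punchIn-punchOut w≢u)) ⟩
    g w + g (punchIn w (punchOut w≢u))
  ≤⟨ +-monoʳ-≤ (g w) (term≤∑ (g ∘ punchIn w) (punchOut w≢u)) ⟩
    g w + ∑[ v < n ] g (punchIn w v)
  ≡⟨ sym (sum-remove {i = w} g) ⟩
    ∑[ v < suc n ] g v
  ∎
  where open ≤-Reasoning

-- Discharging.  A charge  c v u  is sent from u to v along each edge uv;
-- received G c v  is the total charge v receives from its neighbours.

received : ∀ {n} → Graph n → (Fin n → Fin n → ℕ) → Fin n → ℕ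
received {n} G c v = ∑[ u < n ] (if adj G v u then c v u else 0)

degree≡received : ∀ {n} (G : Graph n) v → degree G v ≡ received G (λ _ _ → 1) v
degree≡received G v = count≡∑ (adj G v)

neighbour≤received : ∀ {n} (G : Graph n) c v w → adj G v w ≡ true → c v w ≤ received G c v
neighbour≤received G c v w vw =
  subst (λ b → (if b then c v w else 0) ≤ received G c v) vw
        (term≤∑ (λ u → if adj G v u then c v u else 0) w)

two-neighbours≤received : ∀ {n} (G : Graph n) c v u w → u ≢ w →
  adj G v u ≡ true → adj G v w ≡ true → c v u + c v w ≤ received G c v
two-neighbours≤received G c v u w u≢w vu vw =
  subst₂ (λ b b′ → (if b then c v u else 0) + (if b′ then c v w else 0) ≤ received G c v) vu vw
         (two-terms≤∑ (λ x → if adj G v x then c v x else 0) u w u≢w)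

discharging : ∀ {n} (G : Graph n) Δ → (∀ v → degree G v ≤ Δ) →
  (c : Fin n → Fin n → ℕ) (M : Fin n → ℕ) → (∀ v u → c v u ≤ M u) →
  ∑[ v < n ] received G c v ≤ Δ * ∑[ u < n ] M u
discharging {n} G Δ deg≤Δ c M c≤M = begin
    ∑[ v < n ] ∑[ u < n ] sent v u
  ≡⟨ ∑-comm sent ⟩
    ∑[ u < n ] ∑[ v < n ] sent v u
  ≤⟨ ∑-mono-≤ sent-by≤ ⟩
    ∑[ u < n ] (Δ * M u)
  ≡⟨ sym (*-distribˡ-sum Δ M) ⟩
    Δ * ∑[ u < n ] M u
  ∎
  where
  open ≤-Reasoning
  sent : Fin n → Fin n → ℕ
  sent v u = if adj G v u then c v u else 0
  sent≤ : ∀ u v → sent v u ≤ M u * ind (adj G u v)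
  sent≤ u v rewrite Graph.sym G v u with adj G u v
  ... | true = ≤-trans (c≤M v u) (≤-reflexive (sym (*-identityʳ (M u))))
  ... | false = z≤n
  sent-by≤ : ∀ u → ∑[ v < n ] sent v u ≤ Δ * M u
  sent-by≤ u = begin
      ∑[ v < n ] sent v u
    ≤⟨ ∑-mono-≤ (sent≤ u) ⟩
      ∑[ v < n ] (M u * ind (adj G u v))
    ≡⟨ sym (*-distribˡ-sum (M u) (λ v → ind (adj G u v))) ⟩
      M u * ∑[ v < n ] ind (adj G u v)
    ≡⟨ cong (M u *_) (sym (count≡∑ (adj G u))) ⟩
      M u * degree G u
    ≤⟨ *-monoʳ-≤ (M u) (deg≤Δ u) ⟩
      M u * Δ
    ≡⟨ *-comm (M u) Δ ⟩
      Δ * M u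
    ∎

-- Every dominating set T satisfies  n ≤ |T| + Δ|T| : a vertex outside T
-- receives charge 1 from a neighbour in T, and each vertex of T sends to at
-- most Δ neighbours.
domination-bound : ∀ {n} (G : Graph n) Δ → (∀ v → degree G v ≤ Δ) →
  ∀ T → Dominating G T → n ≤ count T + Δ * count T
domination-bound {n} G Δ deg≤Δ T dom = begin
    n
  ≡⟨ sym (∑-const-1 n) ⟩
    ∑[ v < n ] 1
  ≤⟨ ∑-mono-≤ covered ⟩
    ∑[ v < n ] (ind (T v) + received G c v)
  ≡⟨ ∑-distrib-+ (λ v → ind (T v)) (received G c) ⟩
    ∑[ v < n ] ind (T v) + ∑[ v < n ] received G c v
  ≤⟨ +-mono-≤ (≤-reflexive (sym (count≡∑ T))) (discharging G Δ deg≤Δ c (λ u → ind (T u)) (λ _ _ → ≤-refl)) ⟩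
    count T + Δ * ∑[ u < n ] ind (T u)
  ≡⟨ cong (λ k → count T + Δ * k) (sym (count≡∑ T)) ⟩
    count T + Δ * count T
  ∎
  where
  open ≤-Reasoning
  c : Fin n → Fin n → ℕ
  c v u = ind (T u)
  covered : ∀ v → 1 ≤ ind (T v) + received G c v
  covered v with T v in Tv
  ... | true = s≤s z≤n
  ... | false with dom v Tv
  ...   | w , Tw , vw = subst (λ b → ind b ≤ received G c v) Tw (neighbour≤received G c v w vw)

pattern #0 = fzero
pattern #1 = fsuc fzero
pattern #2 = fsuc (fsuc fzero)
pattern #3 = fsuc (fsuc (fsuc fzero))

δ : Fin 4 → Fin 4 → ℕ
δ j a = ind (does (j Data.Fin.≟ a))

N : ∀ {n} → (Fin n → Fin 4) → Fin 4 → ℕ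
N {n} f j = ∑[ v < n ] δ j (f v)

sum-by-value : ∀ {n} (f : Fin n → Fin 4) (h : Fin 4 → ℕ) →
  ∑[ v < n ] h (f v) ≡ ∑[ j < 4 ] (N f j * h j)
sum-by-value {n} f h = begin
    ∑[ v < n ] h (f v)
  ≡⟨ sum-cong-≗ (λ v → select (f v)) ⟩
    ∑[ v < n ] ∑[ j < 4 ] (δ j (f v) * h j)
  ≡⟨ ∑-comm (λ v j → δ j (f v) * h j) ⟩
    ∑[ j < 4 ] ∑[ v < n ] (δ j (f v) * h j)
  ≡⟨ sum-cong-≗ (λ j → sym (*-distribʳ-sum (h j) (λ v → δ j (f v)))) ⟩
    ∑[ j < 4 ] (N f j * h j)
  ∎
  where
  open ≡-Reasoning
  -- δ picks out the term of index a; for each concrete a the right-hand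
  -- side computes to  h a + 0 + 0
  select : ∀ a → h a ≡ ∑[ j < 4 ] (δ j a * h j)
  select #0 = sym (trans (+-identityʳ _) (+-identityʳ _))
  select #1 = sym (trans (+-identityʳ _) (+-identityʳ _))
  select #2 = sym (trans (+-identityʳ _) (+-identityʳ _))
  select #3 = sym (trans (+-identityʳ _) (+-identityʳ _))

positive : Fin 4 → Bool
positive #0 = false
positive _ = true

module ClassSizes {n : ℕ} (f : Fin n → Fin 4) where
  n₀ n₁ n₂ n₃ : ℕ
  n₀ = N f #0
  n₁ = N f #1
  n₂ = N f #2
  n₃ = N f #3

  order : n ≡ n₀ + n₁ + n₂ + n₃
  order = begin
      n
    ≡⟨ sym (∑-const-1 n) ⟩
      ∑[ v < n ] 1
    ≡⟨ sum-by-value f (λ _ → 1) ⟩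
      n₀ * 1 + (n₁ * 1 + (n₂ * 1 + (n₃ * 1 + 0)))
    ≡⟨ normalise n₀ n₁ n₂ n₃ ⟩
      n₀ + n₁ + n₂ + n₃
    ∎
    where
    open ≡-Reasoning
    normalise : ∀ a b c d → a * 1 + (b * 1 + (c * 1 + (d * 1 + 0))) ≡ a + b + c + d
    normalise = solve-∀

  weight-by-class : weight f ≡ n₁ + 2 * n₂ + 3 * n₃
  weight-by-class = begin
      weight f
    ≡⟨ weight≡∑ f ⟩
      ∑[ v < n ] toℕ (f v)
    ≡⟨ sum-by-value f toℕ ⟩
      n₀ * 0 + (n₁ * 1 + (n₂ * 2 + (n₃ * 3 + 0)))
    ≡⟨ normalise n₀ n₁ n₂ n₃ ⟩
      n₁ + 2 * n₂ + 3 * n₃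
    ∎
    where
    open ≡-Reasoning
    normalise : ∀ a b c d → a * 0 + (b * 1 + (c * 2 + (d * 3 + 0))) ≡ b + 2 * c + 3 * d
    normalise = solve-∀

  positive-count : count (positive ∘ f) ≡ n₁ + n₂ + n₃
  positive-count = begin
      count (positive ∘ f)
    ≡⟨ count≡∑ (positive ∘ f) ⟩
      ∑[ v < n ] ind (positive (f v))
    ≡⟨ sum-by-value f (ind ∘ positive) ⟩
      n₀ * 0 + (n₁ * 1 + (n₂ * 1 + (n₃ * 1 + 0)))
    ≡⟨ normalise n₀ n₁ n₂ n₃ ⟩
      n₁ + n₂ + n₃
    ∎
    where
    open ≡-Reasoning
    normalise : ∀ a b c d → a * 0 + (b * 1 + (c * 1 + (d * 1 + 0))) ≡ b + c + d
    normalise = solve-∀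

discharging-by-value : ∀ {n} (G : Graph n) Δ → (∀ v → degree G v ≤ Δ) →
  (f : Fin n → Fin 4) (κ : Fin 4 → Fin 4 → ℕ) (ρ μ : Fin 4 → ℕ) →
  (∀ a b → κ a b ≤ μ b) →
  (∀ v → ρ (f v) ≤ received G (λ x u → κ (f x) (f u)) v) →
  ∑[ j < 4 ] (N f j * ρ j) ≤ Δ * ∑[ j < 4 ] (N f j * μ j)
discharging-by-value {n} G Δ deg≤Δ f κ ρ μ κ≤μ receives =
  subst₂ _≤_ (sum-by-value f ρ) (cong (Δ *_) (sum-by-value f μ))
    (≤-trans (∑-mono-≤ receives)
             (discharging G Δ deg≤Δ (λ x u → κ (f x) (f u)) (μ ∘ f) (λ x u → κ≤μ (f x) (f u))))

module IDRDFCounts {n : ℕ} (G : Graph n) (f : Fin n → Fin 4) (idr : IsIDRDF G f) where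
  open ClassSizes f

  -- Each 2-vertex sends 1 and each 3-vertex sends 2 to every 0-neighbour; a
  -- 0-vertex has two 2-neighbours or a 3-neighbour, so it receives at least 2.
  zeros-bound : ∀ Δ → (∀ v → degree G v ≤ Δ) → 2 * n₀ ≤ Δ * (n₂ + 2 * n₃)
  zeros-bound Δ deg≤Δ =
    subst₂ _≤_ (normaliseˡ n₀ n₁ n₂ n₃) (cong (Δ *_) (normaliseʳ n₀ n₁ n₂ n₃))
      (discharging-by-value G Δ deg≤Δ f κ ρ μ κ≤μ receives)
    where
    μ : Fin 4 → ℕ
    μ #2 = 1
    μ #3 = 2
    μ _ = 0
    κ : Fin 4 → Fin 4 → ℕ
    κ #0 b = μ b
    κ _ _ = 0
    ρ : Fin 4 → ℕ
    ρ #0 = 2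
    ρ _ = 0
    κ≤μ : ∀ a b → κ a b ≤ μ b
    κ≤μ #0 b = ≤-refl
    κ≤μ (fsuc _) b = z≤n
    μ-of-2 : ∀ b → toℕ b ≡ 2 → μ b ≡ 1
    μ-of-2 #2 refl = refl
    μ-of-3 : ∀ b → toℕ b ≡ 3 → μ b ≡ 2
    μ-of-3 #3 refl = refl
    C : Fin n → Fin n → ℕ
    C x u = κ (f x) (f u)
    from-neighbour : ∀ {v} → f v ≡ #0 → ∀ u → C v u ≡ μ (f u)
    from-neighbour fv u = cong (λ a → κ a (f u)) fv
    receives : ∀ v → ρ (f v) ≤ received G C v
    receives v = receives-at (f v) refl
      where
      receives-at : ∀ a → f v ≡ a → ρ a ≤ received G C v
      receives-at (fsuc _) fv = z≤n
      receives-at #0 fv with proj₁ idr v (cong toℕ fv)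
      ... | inj₁ (u , w , u≢w , vu , vw , fu , fw) =
        subst (_≤ received G C v)
          (cong₂ _+_ (trans (from-neighbour fv u) (μ-of-2 (f u) fu)) (trans (from-neighbour fv w) (μ-of-2 (f w) fw)))
          (two-neighbours≤received G C v u w u≢w vu vw)
      ... | inj₂ (w , vw , fw) =
        subst (_≤ received G C v) (trans (from-neighbour fv w) (μ-of-3 (f w) fw))
          (neighbour≤received G C v w vw)
    normaliseˡ : ∀ a b c d → a * 2 + (b * 0 + (c * 0 + (d * 0 + 0))) ≡ 2 * a
    normaliseˡ = solve-∀
    normaliseʳ : ∀ a b c d → a * 0 + (b * 0 + (c * 1 + (d * 2 + 0))) ≡ c + 2 * d
    normaliseʳ = solve-∀

  -- In a graph of maximum degree ≤ 1 a 0-vertex cannot have two neighbours, so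
  -- it has a 3-neighbour.  A 3-vertex sends 3 to a 0-neighbour or 1 to a
  -- 1-neighbour, a 2-vertex sends 1 to a 1-neighbour; every 1-vertex has a
  -- neighbour of value ≥ 2 and so receives at least 1.
  zeros-and-ones-bound : (∀ v → degree G v ≤ 1) → 3 * n₀ + n₁ ≤ n₂ + 3 * n₃
  zeros-and-ones-bound deg≤1 =
    subst₂ _≤_ (normaliseˡ n₀ n₁ n₂ n₃) (normaliseʳ n₀ n₁ n₂ n₃)
      (discharging-by-value G 1 deg≤1 f κ ρ μ κ≤μ receives)
    where
    μ : Fin 4 → ℕ
    μ #2 = 1
    μ #3 = 3
    μ _ = 0
    κ : Fin 4 → Fin 4 → ℕ
    κ #0 #3 = 3
    κ #1 #2 = 1
    κ #1 #3 = 1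
    κ _ _ = 0
    ρ : Fin 4 → ℕ
    ρ #0 = 3
    ρ #1 = 1
    ρ _ = 0
    κ≤μ : ∀ a b → κ a b ≤ μ b
    κ≤μ #0 #0 = z≤n
    κ≤μ #0 #1 = z≤n
    κ≤μ #0 #2 = z≤n
    κ≤μ #0 #3 = ≤-refl
    κ≤μ #1 #0 = z≤n
    κ≤μ #1 #1 = z≤n
    κ≤μ #1 #2 = ≤-refl
    κ≤μ #1 #3 = s≤s z≤n
    κ≤μ #2 b = z≤n
    κ≤μ #3 b = z≤n
    κ-0-3 : ∀ a b → a ≡ #0 → toℕ b ≡ 3 → κ a b ≡ 3
    κ-0-3 #0 #3 refl refl = refl
    κ-1-big : ∀ a b → a ≡ #1 → toℕ b ≥ 2 → 1 ≤ κ a b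
    κ-1-big #1 #2 refl _ = ≤-refl
    κ-1-big #1 #3 refl _ = ≤-refl
    κ-1-big #1 #0 refl ()
    κ-1-big #1 #1 refl (s≤s ())
    C : Fin n → Fin n → ℕ
    C x u = κ (f x) (f u)
    receives : ∀ v → ρ (f v) ≤ received G C v
    receives v = receives-at (f v) refl
      where
      receives-at : ∀ a → f v ≡ a → ρ a ≤ received G C v
      receives-at #2 fv = z≤n
      receives-at #3 fv = z≤n
      receives-at #1 fv with proj₁ (proj₂ idr) v (cong toℕ fv)
      ... | w , vw , fw = ≤-trans (κ-1-big (f v) (f w) fv fw) (neighbour≤received G C v w vw)
      receives-at #0 fv with proj₁ idr v (cong toℕ fv)
      ... | inj₁ (u , w , u≢w , vu , vw , _ , _) =
        ⊥-elim (1+n≰n (≤-trans (two-neighbours≤received G (λ _ _ → 1) v u w u≢w vu vw)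
                                (subst (_≤ 1) (degree≡received G v) (deg≤1 v))))
      ... | inj₂ (w , vw , fw) =
        subst (_≤ received G C v) (κ-0-3 (f v) (f w) fv fw) (neighbour≤received G C v w vw)
    normaliseˡ : ∀ a b c d → a * 3 + (b * 1 + (c * 0 + (d * 0 + 0))) ≡ 3 * a + b
    normaliseˡ = solve-∀
    normaliseʳ : ∀ a b c d → 1 * (a * 0 + (b * 0 + (c * 1 + (d * 3 + 0)))) ≡ c + 3 * d
    normaliseʳ = solve-∀

  positive-IDS : IsIndDomSet G (positive ∘ f)
  positive-IDS = independent , dominating
    where
    positive⇒≥1 : ∀ a → positive a ≡ true → toℕ a ≥ 1
    positive⇒≥1 (fsuc _) _ = s≤s z≤n
    ¬positive⇒0 : ∀ a → positive a ≡ false → toℕ a ≡ 0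
    ¬positive⇒0 #0 _ = refl
    suc⇒positive : ∀ a k → toℕ a ≡ suc k → positive a ≡ true
    suc⇒positive (fsuc _) _ _ = refl
    independent : Independent G (positive ∘ f)
    independent u v pu pv = proj₂ (proj₂ idr) u v (positive⇒≥1 (f u) pu) (positive⇒≥1 (f v) pv)
    dominating : Dominating G (positive ∘ f)
    dominating v pv with proj₁ idr v (¬positive⇒0 (f v) pv)
    ... | inj₁ (u , _ , _ , vu , _ , fu , _) = u , suc⇒positive (f u) 1 fu , vu
    ... | inj₂ (w , vw , fw) = w , suc⇒positive (f w) 2 fw , vw

bound-arithmetic-Δ≥2 : ∀ d n₀ n₁ n₂ n₃ i → i ≤ n₁ + n₂ + n₃ → 2 * n₀ ≤ (2 + d) * (n₂ + 2 * n₃) →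
  2 * (n₀ + n₁ + n₂ + n₃) + (2 + d) * i ≤ (2 + d) * (n₁ + 2 * n₂ + 3 * n₃) + 2 * i
bound-arithmetic-Δ≥2 d n₀ n₁ n₂ n₃ i i≤pos zeros = begin
    2 * (n₀ + n₁ + n₂ + n₃) + (2 + d) * i
  ≡⟨ regroupˡ d n₀ n₁ n₂ n₃ i ⟩
    2 * n₀ + (2 * (n₁ + n₂ + n₃) + 2 * i + d * i)
  ≤⟨ +-mono-≤ zeros (+-monoʳ-≤ (2 * (n₁ + n₂ + n₃) + 2 * i) (*-monoʳ-≤ d i≤pos)) ⟩
    (2 + d) * (n₂ + 2 * n₃) + (2 * (n₁ + n₂ + n₃) + 2 * i + d * (n₁ + n₂ + n₃))
  ≡⟨ regroupʳ d n₀ n₁ n₂ n₃ i ⟩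
    (2 + d) * (n₁ + 2 * n₂ + 3 * n₃) + 2 * i
  ∎
  where
  open ≤-Reasoning
  regroupˡ : ∀ d n₀ n₁ n₂ n₃ i →
    2 * (n₀ + n₁ + n₂ + n₃) + (2 + d) * i ≡ 2 * n₀ + (2 * (n₁ + n₂ + n₃) + 2 * i + d * i)
  regroupˡ = solve-∀
  regroupʳ : ∀ d n₀ n₁ n₂ n₃ i →
    (2 + d) * (n₂ + 2 * n₃) + (2 * (n₁ + n₂ + n₃) + 2 * i + d * (n₁ + n₂ + n₃))
      ≡ (2 + d) * (n₁ + 2 * n₂ + 3 * n₃) + 2 * i
  regroupʳ = solve-∀

bound-arithmetic-Δ≡1 : ∀ n₀ n₁ n₂ n₃ i → n₀ + n₁ + n₂ + n₃ ≤ 2 * i → 3 * n₀ + n₁ ≤ n₂ + 3 * n₃ →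
  2 * (n₀ + n₁ + n₂ + n₃) + 1 * i ≤ 1 * (n₁ + 2 * n₂ + 3 * n₃) + 2 * i
bound-arithmetic-Δ≡1 n₀ n₁ n₂ n₃ i order≤2i zeros-ones = *-cancelˡ-≤ 2 (begin
    2 * (2 * (n₀ + n₁ + n₂ + n₃) + 1 * i)
  ≡⟨ regroupˡ n₀ n₁ n₂ n₃ i ⟩
    (3 * n₀ + n₁) + (2 * n₁ + 3 * n₂ + 3 * n₃) + (n₀ + n₁ + n₂ + n₃) + 2 * i
  ≤⟨ +-monoˡ-≤ (2 * i) (+-mono-≤ (+-monoˡ-≤ (2 * n₁ + 3 * n₂ + 3 * n₃) zeros-ones) order≤2i) ⟩
    (n₂ + 3 * n₃) + (2 * n₁ + 3 * n₂ + 3 * n₃) + 2 * i + 2 * i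
  ≡⟨ regroupʳ n₀ n₁ n₂ n₃ i ⟩
    2 * (1 * (n₁ + 2 * n₂ + 3 * n₃) + 2 * i)
  ∎)
  where
  open ≤-Reasoning
  regroupˡ : ∀ n₀ n₁ n₂ n₃ i → 2 * (2 * (n₀ + n₁ + n₂ + n₃) + 1 * i)
    ≡ (3 * n₀ + n₁) + (2 * n₁ + 3 * n₂ + 3 * n₃) + (n₀ + n₁ + n₂ + n₃) + 2 * i
  regroupˡ = solve-∀
  regroupʳ : ∀ n₀ n₁ n₂ n₃ i → (n₂ + 3 * n₃) + (2 * n₁ + 3 * n₂ + 3 * n₃) + 2 * i + 2 * i
    ≡ 2 * (1 * (n₁ + 2 * n₂ + 3 * n₃) + 2 * i)
  regroupʳ = solve-∀

-- For Δ ≥ 2 it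
-- uses i ≤ n₁ + n₂ + n₃ (positive vertices dominate) and 2n₀ ≤ Δ(n₂ + 2n₃);
-- for Δ = 1 it uses n ≤ 2i (domination bound) and 3n₀ + n₁ ≤ n₂ + 3n₃.
lower-bound : ∀ {n} (G : Graph n) Δ i (f : Fin n → Fin 4) → (∀ v → degree G v ≤ Δ) → Δ ≥ 1 →
  IsIDRDF G f → IsIndDomNumber G i → 2 * n + Δ * i ≤ Δ * weight f + 2 * i
lower-bound {n} G (suc zero) i f deg≤1 _ idr ((T , (_ , T-dom) , |T|≡i) , _) =
  subst₂ (λ m w → 2 * m + 1 * i ≤ 1 * w + 2 * i) (sym order) (sym weight-by-class)
    (bound-arithmetic-Δ≡1 n₀ n₁ n₂ n₃ i (subst (_≤ 2 * i) order n≤2i) (zeros-and-ones-bound deg≤1))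
  where
  open ClassSizes f
  open IDRDFCounts G f idr
  n≤2i : n ≤ 2 * i
  n≤2i = subst (λ k → n ≤ k + 1 * k) |T|≡i (domination-bound G 1 deg≤1 T T-dom)
lower-bound {n} G (suc (suc d)) i f deg≤Δ _ idr (_ , i-minimal) =
  subst₂ (λ m w → 2 * m + (2 + d) * i ≤ (2 + d) * w + 2 * i) (sym order) (sym weight-by-class)
    (bound-arithmetic-Δ≥2 d n₀ n₁ n₂ n₃ i
      (subst (i ≤_) positive-count (i-minimal (positive ∘ f) positive-IDS))
      (zeros-bound (2 + d) deg≤Δ))
  where
  open ClassSizes f
  open IDRDFCounts G f idr

dominating-nonempty : ∀ {n} (G : Graph n) Δ → (∀ v → degree G v ≤ Δ) →
  ∀ T → Dominating G T → Fin n → 1 ≤ count T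
dominating-nonempty {suc n} G Δ deg≤Δ T dom _ with count T | domination-bound G Δ deg≤Δ T dom
... | suc _ | _ = s≤s z≤n
... | zero | n≤0 with ≤-trans n≤0 (≤-reflexive (*-zeroʳ Δ))
...   | ()

-- Sharpness: the star K₁,Δ with centre 0.  Its centre alone is a minimum
-- independent dominating set (i = 1), and value 3 on the centre is an IDRDF of
-- weight 3, which is minimum by the lower bound itself.
star-adj : ∀ {Δ} → Fin (suc Δ) → Fin (suc Δ) → Bool
star-adj fzero fzero = false
star-adj fzero (fsuc _) = true
star-adj (fsuc _) fzero = true
star-adj (fsuc _) (fsuc _) = false

star : ∀ Δ → Graph (suc Δ)
star Δ = record { adj = star-adj ; sym = symmetric ; irrefl = irreflexive }
  where
  symmetric : ∀ u v → star-adj u v ≡ star-adj v u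
  symmetric fzero fzero = refl
  symmetric fzero (fsuc _) = refl
  symmetric (fsuc _) fzero = refl
  symmetric (fsuc _) (fsuc _) = refl
  irreflexive : ∀ v → star-adj v v ≡ false
  irreflexive fzero = refl
  irreflexive (fsuc _) = refl

star-degree : ∀ Δ → MaxDegree (star (suc Δ)) (suc Δ)
star-degree Δ = degree≤ , fzero , centre-degree
  where
  centre-degree : degree (star (suc Δ)) fzero ≡ suc Δ
  centre-degree = trans (count≡∑ (star-adj {suc Δ} fzero)) (∑-const-1 (suc Δ))
  leaf-degree : ∀ j → degree (star (suc Δ)) (fsuc j) ≡ 1
  leaf-degree j = trans (count≡∑ (star-adj {suc Δ} (fsuc j))) (cong suc (sum-replicate-zero (suc Δ)))
  degree≤ : ∀ v → degree (star (suc Δ)) v ≤ suc Δ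
  degree≤ fzero = ≤-reflexive centre-degree
  degree≤ (fsuc j) = subst (_≤ suc Δ) (sym (leaf-degree j)) (s≤s z≤n)

centre : ∀ {Δ} → Fin (suc Δ) → Bool
centre fzero = true
centre (fsuc _) = false

star-i : ∀ Δ → IsIndDomNumber (star (suc Δ)) 1
star-i Δ = (centre , (independent , dominating) , size) ,
           (λ T (_ , T-dom) → dominating-nonempty (star (suc Δ)) (suc Δ) (proj₁ (star-degree Δ)) T T-dom fzero)
  where
  independent : Independent (star (suc Δ)) centre
  independent fzero fzero _ _ = refl
  independent fzero (fsuc _) _ ()
  independent (fsuc _) _ ()
  dominating : Dominating (star (suc Δ)) centre
  dominating (fsuc _) _ = fzero , refl , refl
  size : count (centre {suc Δ}) ≡ 1
  size = trans (count≡∑ (centre {suc Δ})) (cong suc (sum-replicate-zero (suc Δ)))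

star-extremal : ∀ k → suc k * 3 + 2 * 1 ≡ 2 * suc (suc k) + suc k * 1
star-extremal = solve-∀

centre-3 : ∀ {Δ} → Fin (suc Δ) → Fin 4
centre-3 fzero = #3
centre-3 (fsuc _) = #0

star-idR : ∀ Δ → IsIDRNumber (star (suc Δ)) 3
star-idR Δ = (centre-3 , (zeros , ones , independent) , weight-3) , minimal
  where
  zeros : ∀ v → toℕ (centre-3 v) ≡ 0 → _
  zeros (fsuc _) _ = inj₂ (fzero , refl , refl)
  ones : ∀ v → toℕ (centre-3 v) ≡ 1 → _
  ones fzero ()
  ones (fsuc _) ()
  independent : ∀ u v → toℕ (centre-3 u) ≥ 1 → toℕ (centre-3 v) ≥ 1 → star-adj u v ≡ false
  independent fzero fzero _ _ = refl
  independent fzero (fsuc _) _ ()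
  independent (fsuc _) _ ()
  weight-3 : weight (centre-3 {suc Δ}) ≡ 3
  weight-3 = trans (weight≡∑ (centre-3 {suc Δ})) (cong (3 +_) (sum-replicate-zero (suc Δ)))
  -- the lower bound with n = Δ + 1 and i = 1 reads  Δ·3 + 2 ≤ Δ·w(g) + 2
  minimal : ∀ g → IsIDRDF (star (suc Δ)) g → 3 ≤ weight g
  minimal g g-idr = *-cancelˡ-≤ (suc Δ) (+-cancelʳ-≤ 2 (suc Δ * 3) (suc Δ * weight g)
    (subst (_≤ suc Δ * weight g + 2 * 1) (sym (star-extremal Δ))
      (lower-bound (star (suc Δ)) (suc Δ) 1 g (proj₁ (star-degree Δ)) (s≤s z≤n) g-idr (star-i Δ))))

proposition13 :
    (∀ (n : ℕ) (G : Graph n) (Δ idR i : ℕ) → MaxDegree G Δ → Δ ≥ 1 →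
       IsIDRNumber G idR → IsIndDomNumber G i →
       Δ * idR + 2 * i ≥ 2 * n + Δ * i)
    ×
    (∀ (Δ : ℕ) → Δ ≥ 1 → ∃ λ n → Σ (Graph n) λ G → ∃ λ idR → ∃ λ i →
       MaxDegree G Δ × IsIDRNumber G idR × IsIndDomNumber G i ×
       Δ * idR + 2 * i ≡ 2 * n + Δ * i)
proposition13 = bound , sharp
  where
  bound : ∀ (n : ℕ) (G : Graph n) (Δ idR i : ℕ) → MaxDegree G Δ → Δ ≥ 1 →
    IsIDRNumber G idR → IsIndDomNumber G i → Δ * idR + 2 * i ≥ 2 * n + Δ * i
  bound n G Δ idR i (deg≤Δ , _) Δ≥1 ((f , f-idr , w≡idR) , _) i-number =
    subst (λ w → 2 * n + Δ * i ≤ Δ * w + 2 * i) w≡idR (lower-bound G Δ i f deg≤Δ Δ≥1 f-idr i-number)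
  sharp : ∀ (Δ : ℕ) → Δ ≥ 1 → ∃ λ n → Σ (Graph n) λ G → ∃ λ idR → ∃ λ i →
    MaxDegree G Δ × IsIDRNumber G idR × IsIndDomNumber G i × Δ * idR + 2 * i ≡ 2 * n + Δ * i
  sharp (suc k) _ = suc (suc k) , star (suc k) , 3 , 1 , star-degree k , star-idR k , star-i k , star-extremal k
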